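{- Let $\prod_{k=0}^\infty(1-x^{2^k})=\sum_{n\ge0}\eta_nx^n$ and define $\gamma_n=(\eta_n-\eta_{n+2})/2$ for $n\ge0$. Then every Hankel determinant $H_n$ ($n\ge1$) of the sequence $(\gamma_n)_{n\ge0}$ is an odd integer.
   Context: For a sequence $(c_i)_{i\ge0}$, $H_n=\det(c_{i+j})_{0\le i,j\le n-1}$. -}

module Defs where

open import Data.Nat as ℕ using (ℕ; zero; suc; _∸_; _^_)
open import Data.Integer as ℤ using (ℤ; +_; -[1+_])
open import Data.Rational as ℚ using (ℚ)
open import Data.Fin using (Fin; zero; suc; punchIn; toℕ)
open import Data.Bool using (if_then_else_)
open import Relation.Nullary.Decidable using (⌊_⌋)

Series : Set
Series = ℕ → ℤ

sumTo : ℕ → (ℕ → ℤ) → ℤ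
sumTo zero    f = f 0
sumTo (suc n) f = sumTo n f ℤ.+ f (suc n)

_⊛_ : Series → Series → Series
(f ⊛ g) n = sumTo n (λ i → f i ℤ.* g (n ∸ i))

factor : ℕ → Series
factor k n =
  if ⌊ n ℕ.≟ 0 ⌋ then + 1
  else if ⌊ n ℕ.≟ 2 ^ k ⌋ then -[1+ 0 ]
  else + 0

partialProd : ℕ → Series
partialProd zero    = factor 0
partialProd (suc K) = partialProd K ⊛ factor (suc K)

-- η_n = coefficient of x^n in ∏_{k≥0} (1 - x^(2^k)).
-- Factors with 2^k > n do not affect the coefficient of x^n, and 2^n > n,
-- so the coefficient equals that of the finite product over k = 0..n.
η : ℕ → ℤ
η n = partialProd n n

γ : ℕ → ℚ
γ n = ((η n ℤ.- η (suc (suc n))) ℚ./ 1) ℚ.* (+ 1 ℚ./ 2)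

sumFin : (n : ℕ) → (Fin n → ℚ) → ℚ
sumFin zero    f = ℚ.0ℚ
sumFin (suc n) f = f zero ℚ.+ sumFin n (λ j → f (suc j))

sign : ℕ → ℚ
sign zero    = ℚ.1ℚ
sign (suc k) = ℚ.- sign k

det : (n : ℕ) → (Fin n → Fin n → ℚ) → ℚ
det zero    M = ℚ.1ℚ
det (suc n) M =
  sumFin (suc n) (λ j → sign (toℕ j) ℚ.* M zero j
                          ℚ.* det n (λ r c → M (suc r) (punchIn j c)))

hankel : (ℕ → ℚ) → ℕ → ℚ
hankel c n = det n (λ i j → c (toℕ i ℕ.+ toℕ j))

-- Since ∏ₖ (1 − x^(2^k)) = ∑ₙ (−1)^t(n) xⁿ with t the Thue–Morse sequence, γₙ is the integer
-- ((−1)^t(n) − (−1)^t(n+2))/2, of parity t(n) + t(n+2).  Laplace expansion commutes with reduction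
-- mod 2 (all signs are odd), so Hₙ is an integer whose parity is the determinant over 𝔽₂ of the Hankel
-- matrix of these parities.  They obey g(2h+1) = g(2h) and g(2h+2) = g(2h+1) + g(h), which are also
-- the recurrences of the Motzkin numbers Mₙ mod 2 (from M(n+2) = M(n+1) + ∑ₐ M(a) M(n−a) and the
-- Frobenius map).  Finally the Hankel matrix of the Motzkin numbers is L Lᵀ, where L(i,k) counts Motzkin
-- paths of length i ending at height k; L is lower unitriangular, so the determinant is 1.
module Submission where

open import Defs
open import Data.Bool using (Bool; true; false; not; _xor_; _∧_; if_then_else_)
open import Data.Bool.Properties
  using (xor-∧-commutativeRing; xor-assoc; xor-identityʳ; xor-annihilates-not; ∧-zeroʳ; ∧-comm; ∧-idem; ∧-distribˡ-xor)
open import Data.Empty using (⊥-elim)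
open import Data.Fin using (Fin; toℕ; punchIn)
import Data.Fin as Fin
open import Data.Integer as ℤ using (ℤ; +_; -[1+_])
import Data.Integer.Properties as ℤ
import Data.Integer.Tactic.RingSolver as ℤ-Solver
open import Data.Maybe using (just; nothing)
open import Data.Nat as ℕ
  using (ℕ; zero; suc; _+_; _∸_; _^_; _<_; _≤_; _≤′_; ≤′-refl; ≤′-step; ⌊_/2⌋; z≤n; s≤s; z<s; s<s)
import Data.Nat.Properties as ℕ
open import Data.Nat.Induction using (<-rec)
open import Data.Product using (∃-syntax; _,_)
open import Data.Rational as ℚ using (ℚ; _/_; toℚᵘ; fromℚᵘ)
open import Data.Rational.Properties
  using (fromℚᵘ-cong; fromℚᵘ-toℚᵘ; toℚᵘ-fromℚᵘ; toℚᵘ-homo-+; toℚᵘ-homo-*; toℚᵘ-homo‿-)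
open import Data.Rational.Unnormalised as ℚᵘ using (ℚᵘ; mkℚᵘ)
import Data.Rational.Unnormalised.Properties as ℚᵘ
open import Data.Sum using (inj₁; inj₂)
open import Function using (_∘_)
open import Level using (0ℓ)
open import Relation.Binary.Definitions using (tri<; tri≈; tri>)
open import Relation.Binary.PropositionalEquality
open import Relation.Nullary using (Dec; yes; no; ¬_)
open import Relation.Nullary.Decidable using (isYes; isYes≗does; dec-true; dec-false)
open import Tactic.RingSolver using (solve-∀)
open import Tactic.RingSolver.Core.AlmostCommutativeRing using (AlmostCommutativeRing; fromCommutativeRing)

open ≡-Reasoning

-- Coefficients are normalised in 𝔽₂ itself, so solve-∀ 𝔽₂ also proves identities such as x xor x ≡ false.
𝔽₂ : AlmostCommutativeRing 0ℓ 0ℓ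
𝔽₂ = fromCommutativeRing xor-∧-commutativeRing λ { false → just refl ; true → nothing }

fromℚᵘ-homo-+ : ∀ (p q : ℚᵘ) → fromℚᵘ (p ℚᵘ.+ q) ≡ fromℚᵘ p ℚ.+ fromℚᵘ q
fromℚᵘ-homo-+ p q = begin
  fromℚᵘ (p ℚᵘ.+ q)
    ≡⟨ fromℚᵘ-cong (ℚᵘ.+-cong (ℚᵘ.≃-sym (toℚᵘ-fromℚᵘ p)) (ℚᵘ.≃-sym (toℚᵘ-fromℚᵘ q))) ⟩
  fromℚᵘ (toℚᵘ (fromℚᵘ p) ℚᵘ.+ toℚᵘ (fromℚᵘ q))
    ≡⟨ fromℚᵘ-cong (ℚᵘ.≃-sym (toℚᵘ-homo-+ (fromℚᵘ p) (fromℚᵘ q))) ⟩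
  fromℚᵘ (toℚᵘ (fromℚᵘ p ℚ.+ fromℚᵘ q))
    ≡⟨ fromℚᵘ-toℚᵘ _ ⟩
  fromℚᵘ p ℚ.+ fromℚᵘ q ∎

fromℚᵘ-homo-* : ∀ (p q : ℚᵘ) → fromℚᵘ (p ℚᵘ.* q) ≡ fromℚᵘ p ℚ.* fromℚᵘ q
fromℚᵘ-homo-* p q = begin
  fromℚᵘ (p ℚᵘ.* q)
    ≡⟨ fromℚᵘ-cong (ℚᵘ.*-cong (ℚᵘ.≃-sym (toℚᵘ-fromℚᵘ p)) (ℚᵘ.≃-sym (toℚᵘ-fromℚᵘ q))) ⟩
  fromℚᵘ (toℚᵘ (fromℚᵘ p) ℚᵘ.* toℚᵘ (fromℚᵘ q))
    ≡⟨ fromℚᵘ-cong (ℚᵘ.≃-sym (toℚᵘ-homo-* (fromℚᵘ p) (fromℚᵘ q))) ⟩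
  fromℚᵘ (toℚᵘ (fromℚᵘ p ℚ.* fromℚᵘ q))
    ≡⟨ fromℚᵘ-toℚᵘ _ ⟩
  fromℚᵘ p ℚ.* fromℚᵘ q ∎

fromℚᵘ-homo‿- : ∀ (p : ℚᵘ) → fromℚᵘ (ℚᵘ.- p) ≡ ℚ.- fromℚᵘ p
fromℚᵘ-homo‿- p = begin
  fromℚᵘ (ℚᵘ.- p)                 ≡⟨ fromℚᵘ-cong (ℚᵘ.-‿cong (ℚᵘ.≃-sym (toℚᵘ-fromℚᵘ p))) ⟩
  fromℚᵘ (ℚᵘ.- toℚᵘ (fromℚᵘ p))   ≡⟨ fromℚᵘ-cong (ℚᵘ.≃-sym (toℚᵘ-homo‿- (fromℚᵘ p))) ⟩
  fromℚᵘ (toℚᵘ (ℚ.- fromℚᵘ p))    ≡⟨ fromℚᵘ-toℚᵘ _ ⟩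
  ℚ.- fromℚᵘ p                    ∎

fromℤ : ℤ → ℚ
fromℤ z = z / 1

fromℤ-homo-+ : ∀ a b → fromℤ (a ℤ.+ b) ≡ fromℤ a ℚ.+ fromℤ b
fromℤ-homo-+ a b = begin
  fromℤ (a ℤ.+ b)
    ≡⟨ cong₂ (λ x y → fromℤ (x ℤ.+ y)) (sym (ℤ.*-identityʳ a)) (sym (ℤ.*-identityʳ b)) ⟩
  fromℚᵘ (mkℚᵘ a 0 ℚᵘ.+ mkℚᵘ b 0)
    ≡⟨ fromℚᵘ-homo-+ (mkℚᵘ a 0) (mkℚᵘ b 0) ⟩
  fromℤ a ℚ.+ fromℤ b ∎

fromℤ-homo-* : ∀ a b → fromℤ (a ℤ.* b) ≡ fromℤ a ℚ.* fromℤ b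
fromℤ-homo-* a b = fromℚᵘ-homo-* (mkℚᵘ a 0) (mkℚᵘ b 0)

fromℤ-homo‿- : ∀ a → fromℤ (ℤ.- a) ≡ ℚ.- fromℤ a
fromℤ-homo‿- a = fromℚᵘ-homo‿- (mkℚᵘ a 0)

bit : Bool → ℤ
bit false = + 0
bit true  = + 1

infixl 6 _+2×_

_+2×_ : Bool → ℤ → ℤ
b +2× m = bit b ℤ.+ + 2 ℤ.* m

+2×-+ : ∀ a b m k → (a +2× m) ℤ.+ (b +2× k) ≡ (a xor b) +2× (bit (a ∧ b) ℤ.+ m ℤ.+ k)
+2×-+ a b m k = begin
  (bit a ℤ.+ + 2 ℤ.* m) ℤ.+ (bit b ℤ.+ + 2 ℤ.* k)
    ≡⟨ regroup (bit a) (bit b) m k ⟩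
  (bit a ℤ.+ bit b) ℤ.+ + 2 ℤ.* (m ℤ.+ k)
    ≡⟨ cong (λ s → s ℤ.+ + 2 ℤ.* (m ℤ.+ k)) (carry a b) ⟩
  (bit (a xor b) ℤ.+ + 2 ℤ.* bit (a ∧ b)) ℤ.+ + 2 ℤ.* (m ℤ.+ k)
    ≡⟨ reassociate (bit (a xor b)) (bit (a ∧ b)) m k ⟩
  (a xor b) +2× (bit (a ∧ b) ℤ.+ m ℤ.+ k) ∎
  where
  carry : ∀ a b → bit a ℤ.+ bit b ≡ bit (a xor b) ℤ.+ + 2 ℤ.* bit (a ∧ b)
  carry false false = refl
  carry false true  = refl
  carry true  false = refl
  carry true  true  = refl
  regroup : ∀ x y m k → (x ℤ.+ + 2 ℤ.* m) ℤ.+ (y ℤ.+ + 2 ℤ.* k) ≡ (x ℤ.+ y) ℤ.+ + 2 ℤ.* (m ℤ.+ k)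
  regroup = solve-∀ ℤ-Solver.ring
  reassociate : ∀ x c m k → (x ℤ.+ + 2 ℤ.* c) ℤ.+ + 2 ℤ.* (m ℤ.+ k) ≡ x ℤ.+ + 2 ℤ.* (c ℤ.+ m ℤ.+ k)
  reassociate = solve-∀ ℤ-Solver.ring

+2×-* : ∀ a b m k → (a +2× m) ℤ.* (b +2× k) ≡ (a ∧ b) +2× (bit a ℤ.* k ℤ.+ m ℤ.* bit b ℤ.+ + 2 ℤ.* m ℤ.* k)
+2×-* a b m k = begin
  (bit a ℤ.+ + 2 ℤ.* m) ℤ.* (bit b ℤ.+ + 2 ℤ.* k)  ≡⟨ expand (bit a) (bit b) m k ⟩
  bit a ℤ.* bit b ℤ.+ + 2 ℤ.* c                    ≡⟨ cong (λ p → p ℤ.+ + 2 ℤ.* c) (product a b) ⟩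
  (a ∧ b) +2× c                                    ∎
  where
  c : ℤ
  c = bit a ℤ.* k ℤ.+ m ℤ.* bit b ℤ.+ + 2 ℤ.* m ℤ.* k
  product : ∀ a b → bit a ℤ.* bit b ≡ bit (a ∧ b)
  product false false = refl
  product false true  = refl
  product true  false = refl
  product true  true  = refl
  expand : ∀ x y m k →
    (x ℤ.+ + 2 ℤ.* m) ℤ.* (y ℤ.+ + 2 ℤ.* k) ≡ x ℤ.* y ℤ.+ + 2 ℤ.* (x ℤ.* k ℤ.+ m ℤ.* y ℤ.+ + 2 ℤ.* m ℤ.* k)
  expand = solve-∀ ℤ-Solver.ring

+2×-‿- : ∀ a m → ℤ.- (a +2× m) ≡ a +2× (ℤ.- bit a ℤ.- m)
+2×-‿- a m = negate (bit a) m
  where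
  negate : ∀ x m → ℤ.- (x ℤ.+ + 2 ℤ.* m) ≡ x ℤ.+ + 2 ℤ.* (ℤ.- x ℤ.- m)
  negate = solve-∀ ℤ-Solver.ring

infix 4 _≡₂_

record _≡₂_ (q : ℚ) (b : Bool) : Set where
  constructor _,_
  field
    quotient : ℤ
    equation : q ≡ fromℤ (b +2× quotient)

≡₂-+ : ∀ {x y a b} → x ≡₂ a → y ≡₂ b → x ℚ.+ y ≡₂ a xor b
≡₂-+ {a = a} {b} (m , refl) (k , refl) =
  _ , trans (sym (fromℤ-homo-+ (a +2× m) (b +2× k))) (cong fromℤ (+2×-+ a b m k))

≡₂-* : ∀ {x y a b} → x ≡₂ a → y ≡₂ b → x ℚ.* y ≡₂ a ∧ b
≡₂-* {a = a} {b} (m , refl) (k , refl) =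
  _ , trans (sym (fromℤ-homo-* (a +2× m) (b +2× k))) (cong fromℤ (+2×-* a b m k))

≡₂-‿- : ∀ {x a} → x ≡₂ a → ℚ.- x ≡₂ a
≡₂-‿- {a = a} (m , refl) = _ , trans (sym (fromℤ-homo‿- (a +2× m))) (cong fromℤ (+2×-‿- a m))

Matrix₂ : Set
Matrix₂ = ℕ → ℕ → Bool

Σ₂ : ℕ → (ℕ → Bool) → Bool
Σ₂ zero    f = false
Σ₂ (suc n) f = f 0 xor Σ₂ n (λ j → f (suc j))

punchInℕ : ℕ → ℕ → ℕ
punchInℕ zero    c       = suc c
punchInℕ (suc j) zero    = zero
punchInℕ (suc j) (suc c) = suc (punchInℕ j c)

minor : ℕ → Matrix₂ → Matrix₂
minor j M r c = M (suc r) (punchInℕ j c)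

det₂ : ℕ → Matrix₂ → Bool
det₂ zero    M = true
det₂ (suc n) M = Σ₂ (suc n) (λ j → M 0 j ∧ det₂ n (minor j M))

laplaceTerm : ℕ → Matrix₂ → ℕ → Bool
laplaceTerm n M j = M 0 j ∧ det₂ n (minor j M)

toℕ-punchIn : ∀ {n} (j : Fin (suc n)) (c : Fin n) → toℕ (punchIn j c) ≡ punchInℕ (toℕ j) (toℕ c)
toℕ-punchIn Fin.zero    c           = refl
toℕ-punchIn (Fin.suc j) Fin.zero    = refl
toℕ-punchIn (Fin.suc j) (Fin.suc c) = cong suc (toℕ-punchIn j c)

sign-odd : ∀ k → sign k ≡₂ true
sign-odd zero    = + 0 , refl
sign-odd (suc k) = ≡₂-‿- (sign-odd k)

sumFin-≡₂ : ∀ n {f : Fin n → ℚ} {g : ℕ → Bool} →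
  (∀ j → f j ≡₂ g (toℕ j)) → sumFin n f ≡₂ Σ₂ n g
sumFin-≡₂ zero    eq = + 0 , refl
sumFin-≡₂ (suc n) eq = ≡₂-+ (eq Fin.zero) (sumFin-≡₂ n (λ j → eq (Fin.suc j)))

det-≡₂ : ∀ n {M : Fin n → Fin n → ℚ} {B : Matrix₂} →
  (∀ i j → M i j ≡₂ B (toℕ i) (toℕ j)) → det n M ≡₂ det₂ n B
det-≡₂ zero    eq = + 0 , refl
det-≡₂ (suc n) {M} {B} eq = sumFin-≡₂ (suc n) {g = laplaceTerm n B} λ j →
  ≡₂-* (≡₂-* (sign-odd (toℕ j)) (eq Fin.zero j)) (det-≡₂ n {B = minor (toℕ j) B} λ r c →
    subst (λ k → M (Fin.suc r) (punchIn j c) ≡₂ B (suc (toℕ r)) k)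
          (toℕ-punchIn j c) (eq (Fin.suc r) (punchIn j c)))

Σ₂-cong : ∀ n {f g : ℕ → Bool} → (∀ j → j < n → f j ≡ g j) → Σ₂ n f ≡ Σ₂ n g
Σ₂-cong zero    eq = refl
Σ₂-cong (suc n) eq = cong₂ _xor_ (eq 0 z<s) (Σ₂-cong n λ j j<n → eq (suc j) (s<s j<n))

Σ₂-zero : ∀ n {f : ℕ → Bool} → (∀ j → j < n → f j ≡ false) → Σ₂ n f ≡ false
Σ₂-zero zero    eq = refl
Σ₂-zero (suc n) eq = cong₂ _xor_ (eq 0 z<s) (Σ₂-zero n λ j j<n → eq (suc j) (s<s j<n))

Σ₂-xor : ∀ n (f g : ℕ → Bool) → Σ₂ n (λ j → f j xor g j) ≡ Σ₂ n f xor Σ₂ n g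
Σ₂-xor zero    f g = refl
Σ₂-xor (suc n) f g =
  trans (cong ((f 0 xor g 0) xor_) (Σ₂-xor n (λ j → f (suc j)) (λ j → g (suc j))))
        (interchange (f 0) (g 0) _ _)
  where
  interchange : ∀ a b c d → (a xor b) xor (c xor d) ≡ (a xor c) xor (b xor d)
  interchange = solve-∀ 𝔽₂

Σ₂-∧ˡ : ∀ n a (f : ℕ → Bool) → Σ₂ n (λ j → a ∧ f j) ≡ a ∧ Σ₂ n f
Σ₂-∧ˡ zero    a f = sym (∧-zeroʳ a)
Σ₂-∧ˡ (suc n) a f =
  trans (cong ((a ∧ f 0) xor_) (Σ₂-∧ˡ n a (λ j → f (suc j)))) (sym (∧-distribˡ-xor a (f 0) _))

Σ₂-last : ∀ n (f : ℕ → Bool) → Σ₂ (suc n) f ≡ Σ₂ n f xor f n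
Σ₂-last zero    f = xor-identityʳ (f 0)
Σ₂-last (suc n) f = trans (cong (f 0 xor_) (Σ₂-last n (λ j → f (suc j)))) (sym (xor-assoc (f 0) _ _))

Σ₂-extend : ∀ d m {f : ℕ → Bool} → (∀ k → m ≤ k → f k ≡ false) → Σ₂ (d + m) f ≡ Σ₂ m f
Σ₂-extend zero    m eq = refl
Σ₂-extend (suc d) m {f} eq = begin
  Σ₂ (suc (d + m)) f          ≡⟨ Σ₂-last (d + m) f ⟩
  Σ₂ (d + m) f xor f (d + m)  ≡⟨ cong₂ _xor_ (Σ₂-extend d m eq) (eq (d + m) (ℕ.m≤n+m m d)) ⟩
  Σ₂ m f xor false            ≡⟨ xor-identityʳ _ ⟩
  Σ₂ m f                      ∎

swapAt : ℕ → ℕ → ℕ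
swapAt zero    zero          = 1
swapAt zero    (suc zero)    = 0
swapAt zero    (suc (suc k)) = suc (suc k)
swapAt (suc c) zero          = zero
swapAt (suc c) (suc k)       = suc (swapAt c k)

Σ₂-swapAt : ∀ n c (f : ℕ → Bool) → suc c < n → Σ₂ n (f ∘ swapAt c) ≡ Σ₂ n f
Σ₂-swapAt (suc (suc n)) zero    f _         = exchange (f 1) (f 0) _
  where
  exchange : ∀ a b c → a xor (b xor c) ≡ b xor (a xor c)
  exchange = solve-∀ 𝔽₂
Σ₂-swapAt (suc n)       (suc c) f (s<s c<n) = cong (f 0 xor_) (Σ₂-swapAt n c (f ∘ suc) c<n)

Σ₂-adjacentPair : ∀ n c (f : ℕ → Bool) → suc c < n →
  (∀ j → j < n → j ≢ c → j ≢ suc c → f j ≡ false) → f c ≡ f (suc c) → Σ₂ n f ≡ false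
Σ₂-adjacentPair (suc (suc n)) zero f _ others f₀≡f₁ = begin
  f 0 xor (f 1 xor Σ₂ n (f ∘ suc ∘ suc)) ≡⟨ cong₂ (λ x y → x xor (f 1 xor y)) f₀≡f₁ rest ⟩
  f 1 xor (f 1 xor false)                ≡⟨ cancel (f 1) ⟩
  false                                  ∎
  where
  rest : Σ₂ n (f ∘ suc ∘ suc) ≡ false
  rest = Σ₂-zero n λ j j<n → others (suc (suc j)) (s<s (s<s j<n)) (λ ()) (λ ())
  cancel : ∀ a → a xor (a xor false) ≡ false
  cancel = solve-∀ 𝔽₂
Σ₂-adjacentPair (suc n) (suc c) f (s<s c<n) others eq =
  trans (cong (_xor Σ₂ n (f ∘ suc)) (others 0 z<s (λ ()) (λ ())))
        (Σ₂-adjacentPair n c (f ∘ suc) c<n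
          (λ j j<n j≢c j≢c+1 →
            others (suc j) (s<s j<n) (j≢c ∘ ℕ.suc-injective) (j≢c+1 ∘ ℕ.suc-injective))
          eq)

punchOutℕ : ℕ → ℕ → ℕ
punchOutℕ zero    zero    = zero
punchOutℕ zero    (suc m) = m
punchOutℕ (suc j) zero    = zero
punchOutℕ (suc j) (suc m) = suc (punchOutℕ j m)

punchInℕ-≢ : ∀ j c → punchInℕ j c ≢ j
punchInℕ-≢ (suc j) (suc c) eq = punchInℕ-≢ j c (ℕ.suc-injective eq)

punchInℕ-injective : ∀ j c c′ → punchInℕ j c ≡ punchInℕ j c′ → c ≡ c′
punchInℕ-injective zero    c       c′       eq = ℕ.suc-injective eq
punchInℕ-injective (suc j) zero    zero     eq = refl
punchInℕ-injective (suc j) (suc c) (suc c′) eq = cong suc (punchInℕ-injective j c c′ (ℕ.suc-injective eq))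

punchInℕ-punchOutℕ : ∀ j m → j ≢ m → punchInℕ j (punchOutℕ j m) ≡ m
punchInℕ-punchOutℕ zero    zero    j≢m = ⊥-elim (j≢m refl)
punchInℕ-punchOutℕ zero    (suc m) j≢m = refl
punchInℕ-punchOutℕ (suc j) zero    j≢m = refl
punchInℕ-punchOutℕ (suc j) (suc m) j≢m = cong suc (punchInℕ-punchOutℕ j m (j≢m ∘ cong suc))

punchOutℕ-< : ∀ {n} j m → j ≢ m → j < suc n → m < suc n → punchOutℕ j m < n
punchOutℕ-< zero    zero    j≢m _         _         = ⊥-elim (j≢m refl)
punchOutℕ-< zero    (suc m) j≢m _         (s<s m<n) = m<n
punchOutℕ-< {zero}  (suc j) zero    j≢m (s<s ()) _
punchOutℕ-< {suc n} (suc j) zero    j≢m _ _         = z<s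
punchOutℕ-< {suc n} (suc j) (suc m) j≢m (s<s j<n) (s<s m<n) =
  s<s (punchOutℕ-< j m (j≢m ∘ cong suc) j<n m<n)

punchInℕ-≤ : ∀ j c → punchInℕ j c ≤ suc c
punchInℕ-≤ zero    c       = ℕ.≤-refl
punchInℕ-≤ (suc j) zero    = z≤n
punchInℕ-≤ (suc j) (suc c) = s≤s (punchInℕ-≤ j c)

punchInℕ-< : ∀ j c → c < j → punchInℕ j c ≡ c
punchInℕ-< (suc j) zero    _         = refl
punchInℕ-< (suc j) (suc c) (s<s c<j) = cong suc (punchInℕ-< j c c<j)

punchInℕ-≥ : ∀ j c → j ≤ c → punchInℕ j c ≡ suc c
punchInℕ-≥ zero    c       _         = refl
punchInℕ-≥ (suc j) (suc c) (s≤s j≤c) = cong suc (punchInℕ-≥ j c j≤c)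

det₂-cong : ∀ n {M N : Matrix₂} → (∀ r c → r < n → c < n → M r c ≡ N r c) → det₂ n M ≡ det₂ n N
det₂-cong zero    eq = refl
det₂-cong (suc n) eq = Σ₂-cong (suc n) λ j j<n →
  cong₂ _∧_ (eq 0 j z<s j<n) (det₂-cong n λ r c r<n c<n →
    eq (suc r) (punchInℕ j c) (s<s r<n) (s≤s (ℕ.≤-trans (punchInℕ-≤ j c) c<n)))

AgreeOff : ℕ → Matrix₂ → Matrix₂ → Set
AgreeOff m M N = ∀ r c → c ≢ m → M r c ≡ N r c

minor-agreeOff-self : ∀ {m M N} → AgreeOff m M N → ∀ r c → minor m M r c ≡ minor m N r c
minor-agreeOff-self {m} M≈N r c = M≈N (suc r) (punchInℕ m c) (punchInℕ-≢ m c)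

minor-agreeOff : ∀ {j m M N} → j ≢ m → AgreeOff m M N → AgreeOff (punchOutℕ j m) (minor j M) (minor j N)
minor-agreeOff {j} {m} j≢m M≈N r c c≢m′ = M≈N (suc r) (punchInℕ j c) λ eq →
  c≢m′ (punchInℕ-injective j c _ (trans eq (sym (punchInℕ-punchOutℕ j m j≢m))))

det₂-linear : ∀ n {m a M M₁ M₂} → m < n → AgreeOff m M M₁ → AgreeOff m M M₂ →
  (∀ r → M r m ≡ (a ∧ M₁ r m) xor M₂ r m) → det₂ n M ≡ (a ∧ det₂ n M₁) xor det₂ n M₂
det₂-linear (suc n) {m} {a} {M} {M₁} {M₂} m<n M≈M₁ M≈M₂ column = begin
  Σ₂ (suc n) (laplaceTerm n M)
    ≡⟨ Σ₂-cong (suc n) termwise ⟩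
  Σ₂ (suc n) (λ j → (a ∧ laplaceTerm n M₁ j) xor laplaceTerm n M₂ j)
    ≡⟨ Σ₂-xor (suc n) (λ j → a ∧ laplaceTerm n M₁ j) (laplaceTerm n M₂) ⟩
  Σ₂ (suc n) (λ j → a ∧ laplaceTerm n M₁ j) xor det₂ (suc n) M₂
    ≡⟨ cong (_xor det₂ (suc n) M₂) (Σ₂-∧ˡ (suc n) a (laplaceTerm n M₁)) ⟩
  (a ∧ det₂ (suc n) M₁) xor det₂ (suc n) M₂ ∎
  where
  termwise : ∀ j → j < suc n → laplaceTerm n M j ≡ (a ∧ laplaceTerm n M₁ j) xor laplaceTerm n M₂ j
  termwise j j<n with j ℕ.≟ m
  ... | yes refl = begin
    M 0 j ∧ det₂ n (minor j M)
      ≡⟨ cong₂ _∧_ (column 0) (det₂-cong n λ r c _ _ → minor-agreeOff-self M≈M₁ r c) ⟩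
    ((a ∧ M₁ 0 j) xor M₂ 0 j) ∧ det₂ n (minor j M₁)
      ≡⟨ distrib a (M₁ 0 j) (M₂ 0 j) _ ⟩
    (a ∧ laplaceTerm n M₁ j) xor (M₂ 0 j ∧ det₂ n (minor j M₁))
      ≡⟨ cong (λ d → (a ∧ laplaceTerm n M₁ j) xor (M₂ 0 j ∧ d)) (det₂-cong n λ r c _ _ →
           trans (sym (minor-agreeOff-self M≈M₁ r c)) (minor-agreeOff-self M≈M₂ r c)) ⟩
    (a ∧ laplaceTerm n M₁ j) xor laplaceTerm n M₂ j ∎
    where
    distrib : ∀ a x y d → ((a ∧ x) xor y) ∧ d ≡ (a ∧ (x ∧ d)) xor (y ∧ d)
    distrib = solve-∀ 𝔽₂
  ... | no j≢m = begin
    M 0 j ∧ det₂ n (minor j M)                                ≡⟨ cong (M 0 j ∧_) minorLinear ⟩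
    M 0 j ∧ ((a ∧ det₂ n (minor j M₁)) xor det₂ n (minor j M₂)) ≡⟨ distrib (M 0 j) a _ _ ⟩
    (a ∧ (M 0 j ∧ det₂ n (minor j M₁))) xor (M 0 j ∧ det₂ n (minor j M₂))
      ≡⟨ cong₂ (λ x y → (a ∧ (x ∧ det₂ n (minor j M₁))) xor (y ∧ det₂ n (minor j M₂)))
               (M≈M₁ 0 j j≢m) (M≈M₂ 0 j j≢m) ⟩
    (a ∧ laplaceTerm n M₁ j) xor laplaceTerm n M₂ j             ∎
    where
    distrib : ∀ e a x y → e ∧ ((a ∧ x) xor y) ≡ (a ∧ (e ∧ x)) xor (e ∧ y)
    distrib = solve-∀ 𝔽₂
    minorLinear : det₂ n (minor j M) ≡ (a ∧ det₂ n (minor j M₁)) xor det₂ n (minor j M₂)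
    minorLinear = det₂-linear n {a = a} (punchOutℕ-< j m j≢m j<n m<n)
      (minor-agreeOff j≢m M≈M₁) (minor-agreeOff j≢m M≈M₂)
      (λ r → subst (λ c → M (suc r) c ≡ (a ∧ M₁ (suc r) c) xor M₂ (suc r) c)
                   (sym (punchInℕ-punchOutℕ j m j≢m)) (column (suc r)))

swapAt-self : ∀ c → swapAt c c ≡ suc c
swapAt-self zero    = refl
swapAt-self (suc c) = cong suc (swapAt-self c)

swapAt-suc : ∀ c → swapAt c (suc c) ≡ c
swapAt-suc zero    = refl
swapAt-suc (suc c) = cong suc (swapAt-suc c)

swapAt-< : ∀ c j → j < c → swapAt c j ≡ j
swapAt-< (suc c) zero    _         = refl
swapAt-< (suc c) (suc j) (s<s j<c) = cong suc (swapAt-< c j j<c)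

swapAt-> : ∀ c j → suc c < j → swapAt c j ≡ j
swapAt-> zero    (suc zero)    (s<s ())
swapAt-> zero    (suc (suc j)) _         = refl
swapAt-> (suc c) (suc j)       (s<s c<j) = cong suc (swapAt-> c j c<j)

swapAt-punchInℕ-self : ∀ c k → swapAt c (punchInℕ c k) ≡ punchInℕ (suc c) k
swapAt-punchInℕ-self zero    zero    = refl
swapAt-punchInℕ-self zero    (suc k) = refl
swapAt-punchInℕ-self (suc c) zero    = refl
swapAt-punchInℕ-self (suc c) (suc k) = cong suc (swapAt-punchInℕ-self c k)

swapAt-punchInℕ-suc : ∀ c k → swapAt c (punchInℕ (suc c) k) ≡ punchInℕ c k
swapAt-punchInℕ-suc zero    zero    = refl
swapAt-punchInℕ-suc zero    (suc k) = refl
swapAt-punchInℕ-suc (suc c) zero    = refl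
swapAt-punchInℕ-suc (suc c) (suc k) = cong suc (swapAt-punchInℕ-suc c k)

swapAt-punchInℕ-≤ : ∀ c j k → j ≤ c → swapAt (suc c) (punchInℕ j k) ≡ punchInℕ j (swapAt c k)
swapAt-punchInℕ-≤ c       zero    k       _         = refl
swapAt-punchInℕ-≤ (suc c) (suc j) zero    _         = refl
swapAt-punchInℕ-≤ (suc c) (suc j) (suc k) (s≤s j≤c) = cong suc (swapAt-punchInℕ-≤ c j k j≤c)

swapAt-punchInℕ-> : ∀ c j k → suc c < j → swapAt c (punchInℕ j k) ≡ punchInℕ j (swapAt c k)
swapAt-punchInℕ-> zero    (suc zero)    k             (s<s ())
swapAt-punchInℕ-> zero    (suc (suc j)) zero          _         = refl
swapAt-punchInℕ-> zero    (suc (suc j)) (suc zero)    _         = refl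
swapAt-punchInℕ-> zero    (suc (suc j)) (suc (suc k)) _         = refl
swapAt-punchInℕ-> (suc c) (suc j)       zero          _         = refl
swapAt-punchInℕ-> (suc c) (suc j)       (suc k)       (s<s c<j) = cong suc (swapAt-punchInℕ-> c j k c<j)

det₂-swapAt : ∀ n c M → suc c < n → det₂ n (λ r k → M r (swapAt c k)) ≡ det₂ n M
det₂-swapAt (suc n) c M c+1<n =
  trans (Σ₂-cong (suc n) λ j j<n → cong (M 0 (swapAt c j) ∧_) (minor-swapped c c+1<n j j<n))
        (Σ₂-swapAt (suc n) c (laplaceTerm n M) c+1<n)
  where
  minor-swapped : ∀ c → suc c < suc n → ∀ j → j < suc n →
    det₂ n (minor j (λ r k → M r (swapAt c k))) ≡ det₂ n (minor (swapAt c j) M)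
  minor-swapped c c+1<n j j<n with ℕ.<-cmp j c
  minor-swapped (suc c′) (s<s c′+1<n) j j<n | tri< j<c _ _ = begin
    det₂ n (λ r k → M (suc r) (swapAt (suc c′) (punchInℕ j k)))
      ≡⟨ det₂-cong n (λ r k _ _ → cong (M (suc r)) (swapAt-punchInℕ-≤ c′ j k (ℕ.≤-pred j<c))) ⟩
    det₂ n (λ r k → minor j M r (swapAt c′ k))
      ≡⟨ det₂-swapAt n c′ (minor j M) c′+1<n ⟩
    det₂ n (minor j M)
      ≡⟨ cong (λ i → det₂ n (minor i M)) (sym (swapAt-< (suc c′) j j<c)) ⟩
    det₂ n (minor (swapAt (suc c′) j) M) ∎
  minor-swapped c c+1<n j j<n | tri≈ _ refl _ = begin
    det₂ n (λ r k → M (suc r) (swapAt j (punchInℕ j k)))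
      ≡⟨ det₂-cong n (λ r k _ _ → cong (M (suc r)) (swapAt-punchInℕ-self j k)) ⟩
    det₂ n (minor (suc j) M)         ≡⟨ cong (λ i → det₂ n (minor i M)) (sym (swapAt-self j)) ⟩
    det₂ n (minor (swapAt j j) M)    ∎
  minor-swapped c c+1<n j j<n | tri> _ _ c<j with ℕ.m≤n⇒m<n∨m≡n c<j
  ... | inj₂ refl = begin
    det₂ n (λ r k → M (suc r) (swapAt c (punchInℕ (suc c) k)))
      ≡⟨ det₂-cong n (λ r k _ _ → cong (M (suc r)) (swapAt-punchInℕ-suc c k)) ⟩
    det₂ n (minor c M)                     ≡⟨ cong (λ i → det₂ n (minor i M)) (sym (swapAt-suc c)) ⟩
    det₂ n (minor (swapAt c (suc c)) M)    ∎
  ... | inj₁ c+1<j = begin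
    det₂ n (λ r k → M (suc r) (swapAt c (punchInℕ j k)))
      ≡⟨ det₂-cong n (λ r k _ _ → cong (M (suc r)) (swapAt-punchInℕ-> c j k c+1<j)) ⟩
    det₂ n (λ r k → minor j M r (swapAt c k))
      ≡⟨ det₂-swapAt n c (minor j M) (ℕ.<-≤-trans c+1<j (ℕ.≤-pred j<n)) ⟩
    det₂ n (minor j M)
      ≡⟨ cong (λ i → det₂ n (minor i M)) (sym (swapAt-> c j c+1<j)) ⟩
    det₂ n (minor (swapAt c j) M) ∎

minor-adjacentEqual : ∀ c (M : Matrix₂) → (∀ r → M r c ≡ M r (suc c)) →
  ∀ r k → M r (punchInℕ c k) ≡ M r (punchInℕ (suc c) k)
minor-adjacentEqual zero    M same r zero    = sym (same r)
minor-adjacentEqual zero    M same r (suc k) = refl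
minor-adjacentEqual (suc c) M same r zero    = refl
minor-adjacentEqual (suc c) M same r (suc k) = minor-adjacentEqual c (λ r x → M r (suc x)) same r k

det₂-adjacentEqual : ∀ n c M → suc c < n → (∀ r → M r c ≡ M r (suc c)) → det₂ n M ≡ false
det₂-adjacentEqual (suc n) c M c+1<n same =
  Σ₂-adjacentPair (suc n) c (laplaceTerm n M) c+1<n (vanishing c c+1<n same)
    (cong₂ _∧_ (same 0) (det₂-cong n λ r k _ _ → minor-adjacentEqual c M same (suc r) k))
  where
  termVanishes : ∀ j c → suc c < n → (∀ r → minor j M r c ≡ minor j M r (suc c)) → laplaceTerm n M j ≡ false
  termVanishes j c c+1<n same = trans (cong (M 0 j ∧_) (det₂-adjacentEqual n c (minor j M) c+1<n same)) (∧-zeroʳ (M 0 j))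
  vanishing : ∀ c → suc c < suc n → (∀ r → M r c ≡ M r (suc c)) →
    ∀ j → j < suc n → j ≢ c → j ≢ suc c → laplaceTerm n M j ≡ false
  vanishing c c+1<n same j j<n j≢c j≢c+1 with ℕ.<-cmp j c
  ... | tri≈ _ j≡c _ = ⊥-elim (j≢c j≡c)
  vanishing (suc c) (s<s c+1<n) same j j<n j≢c j≢c+1 | tri< j<c _ _ =
    let j≤c = ℕ.≤-pred j<c in
    termVanishes j c c+1<n λ r →
      trans (cong (M (suc r)) (punchInℕ-≥ j c j≤c))
            (trans (same (suc r)) (cong (M (suc r)) (sym (punchInℕ-≥ j (suc c) (ℕ.m≤n⇒m≤1+n j≤c)))))
  vanishing c c+1<n same j j<n j≢c j≢c+1 | tri> _ _ c<j with ℕ.m≤n⇒m<n∨m≡n c<j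
  ... | inj₂ c+1≡j = ⊥-elim (j≢c+1 (sym c+1≡j))
  ... | inj₁ c+1<j =
    termVanishes j c (ℕ.<-≤-trans c+1<j (ℕ.≤-pred j<n)) λ r →
      trans (cong (M (suc r)) (punchInℕ-< j c (ℕ.<-trans (ℕ.n<1+n c) c+1<j)))
            (trans (same (suc r)) (cong (M (suc r)) (sym (punchInℕ-< j (suc c) c+1<j))))

det₂-equalColumns : ∀ n {a b} M → a < b → b < n → (∀ r → M r a ≡ M r b) → det₂ n M ≡ false
det₂-equalColumns n {a} {suc b} M (s≤s a≤b) b+1<n same with ℕ.m≤n⇒m<n∨m≡n a≤b
... | inj₂ refl = det₂-adjacentEqual n a M b+1<n same
... | inj₁ a<b  = trans (sym (det₂-swapAt n b M b+1<n))
  (det₂-equalColumns n (λ r k → M r (swapAt b k)) a<b (ℕ.<-trans (ℕ.n<1+n b) b+1<n) λ r →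
    trans (cong (M r) (swapAt-< b a a<b)) (trans (same r) (cong (M r) (sym (swapAt-self b)))))

setColumn : ℕ → (ℕ → Bool) → Matrix₂ → Matrix₂
setColumn m v M r c with c ℕ.≟ m
... | yes _ = v r
... | no  _ = M r c

setColumn-column : ∀ m v M r → setColumn m v M r m ≡ v r
setColumn-column m v M r with m ℕ.≟ m
... | yes _   = refl
... | no  m≢m = ⊥-elim (m≢m refl)

setColumn-agreeOff : ∀ m v M → AgreeOff m (setColumn m v M) M
setColumn-agreeOff m v M r c c≢m with c ℕ.≟ m
... | yes c≡m = ⊥-elim (c≢m c≡m)
... | no  _   = refl

det₂-addCombination : ∀ n t {m} {a : ℕ → Bool} {M N} → t ≤ m → m < n → AgreeOff m N M →
  (∀ r → N r m ≡ M r m xor Σ₂ t (λ k → a k ∧ M r k)) → det₂ n N ≡ det₂ n M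
det₂-addCombination n zero {m} {M = M} {N} _ _ N≈M column = det₂-cong n λ r c _ _ → sameEntry r c
  where
  sameEntry : ∀ r c → N r c ≡ M r c
  sameEntry r c with c ℕ.≟ m
  ... | yes refl = trans (column r) (xor-identityʳ (M r c))
  ... | no  c≢m  = N≈M r c c≢m
det₂-addCombination n (suc t) {m} {a} {M} {N} t<m m<n N≈M column = begin
  det₂ n N                            ≡⟨ det₂-linear n {a = a t} m<n N≈E N≈N′ column′ ⟩
  (a t ∧ det₂ n E) xor det₂ n N′      ≡⟨ cong₂ (λ x y → (a t ∧ x) xor y) E-singular N′-unchanged ⟩
  (a t ∧ false) xor det₂ n M          ≡⟨ cong (_xor det₂ n M) (∧-zeroʳ (a t)) ⟩
  det₂ n M                            ∎
  where
  E N′ : Matrix₂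
  E  = setColumn m (λ r → M r t) M
  N′ = setColumn m (λ r → M r m xor Σ₂ t (λ k → a k ∧ M r k)) M
  N≈E : AgreeOff m N E
  N≈E r c c≢m = trans (N≈M r c c≢m) (sym (setColumn-agreeOff m _ M r c c≢m))
  N≈N′ : AgreeOff m N N′
  N≈N′ r c c≢m = trans (N≈M r c c≢m) (sym (setColumn-agreeOff m _ M r c c≢m))
  column′ : ∀ r → N r m ≡ (a t ∧ E r m) xor N′ r m
  column′ r = begin
    N r m
      ≡⟨ column r ⟩
    M r m xor Σ₂ (suc t) (λ k → a k ∧ M r k)
      ≡⟨ cong (M r m xor_) (Σ₂-last t (λ k → a k ∧ M r k)) ⟩
    M r m xor (Σ₂ t (λ k → a k ∧ M r k) xor (a t ∧ M r t))
      ≡⟨ rotate (M r m) (Σ₂ t (λ k → a k ∧ M r k)) (a t ∧ M r t) ⟩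
    (a t ∧ M r t) xor (M r m xor Σ₂ t (λ k → a k ∧ M r k))
      ≡⟨ sym (cong₂ (λ x y → (a t ∧ x) xor y)
             (setColumn-column m _ M r) (setColumn-column m _ M r)) ⟩
    (a t ∧ E r m) xor N′ r m ∎
    where
    rotate : ∀ x y z → x xor (y xor z) ≡ z xor (x xor y)
    rotate = solve-∀ 𝔽₂
  E-singular : det₂ n E ≡ false
  E-singular = det₂-equalColumns n E t<m m<n λ r →
    trans (setColumn-agreeOff m _ M r t (ℕ.<⇒≢ t<m)) (sym (setColumn-column m _ M r))
  N′-unchanged : det₂ n N′ ≡ det₂ n M
  N′-unchanged = det₂-addCombination n t (ℕ.<⇒≤ t<m) m<n (setColumn-agreeOff m _ M) (setColumn-column m _ M)

record LowerUnitriangular (n : ℕ) (L : Matrix₂) : Set where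
  field
    above    : ∀ i j → i < j → j < n → L i j ≡ false
    diagonal : ∀ i → i < n → L i i ≡ true

det₂-lowerUnitriangular : ∀ n {L} → LowerUnitriangular n L → det₂ n L ≡ true
det₂-lowerUnitriangular zero    _ = refl
det₂-lowerUnitriangular (suc n) {L} lower = begin
  (L 0 0 ∧ det₂ n (minor 0 L)) xor Σ₂ n (λ j → laplaceTerm n L (suc j))
    ≡⟨ cong₂ (λ x y → (x ∧ det₂ n (minor 0 L)) xor y) (diagonal 0 z<s)
             (Σ₂-zero n λ j j<n → cong (_∧ det₂ n (minor (suc j) L)) (above 0 (suc j) z<s (s<s j<n))) ⟩
  det₂ n (minor 0 L) xor false
    ≡⟨ cong (_xor false) (det₂-lowerUnitriangular n record
         { above    = λ i j i<j j<n → above (suc i) (suc j) (s<s i<j) (s<s j<n)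
         ; diagonal = λ i i<n → diagonal (suc i) (s<s i<n) }) ⟩
  true ∎
  where open LowerUnitriangular lower

-- For lower triangular L this is L Lᵀ: the terms with k > c vanish.
gram : Matrix₂ → Matrix₂
gram L r c = Σ₂ (suc c) (λ k → L r k ∧ L c k)

det₂-gram : ∀ n {L} → LowerUnitriangular n L → det₂ n (gram L) ≡ true
det₂-gram n {L} lower =
  trans (det₂-cong n λ r c _ _ → sym (partial-≮ {0} r c λ ())) (reduce n 0 (ℕ.+-identityʳ n))
  where
  open LowerUnitriangular lower

  partial : ℕ → Matrix₂
  partial m r c with c ℕ.<? m
  ... | yes _ = L r c
  ... | no  _ = gram L r c

  partial-< : ∀ {m} r c → c < m → partial m r c ≡ L r c
  partial-< {m} r c c<m with c ℕ.<? m
  ... | yes _   = refl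
  ... | no  c≮m = ⊥-elim (c≮m c<m)

  partial-≮ : ∀ {m} r c → ¬ c < m → partial m r c ≡ gram L r c
  partial-≮ {m} r c c≮m with c ℕ.<? m
  ... | yes c<m = ⊥-elim (c≮m c<m)
  ... | no  _   = refl

  reduceColumn : ∀ m → m < n → det₂ n (partial m) ≡ det₂ n (partial (suc m))
  reduceColumn m m<n = det₂-addCombination n m {a = L m} ℕ.≤-refl m<n agree column
    where
    agree : AgreeOff m (partial m) (partial (suc m))
    agree r c c≢m with ℕ.<-cmp c m
    ... | tri< c<m _ _ = trans (partial-< r c c<m) (sym (partial-< r c (ℕ.m<n⇒m<1+n c<m)))
    ... | tri≈ _ c≡m _ = ⊥-elim (c≢m c≡m)
    ... | tri> c≮m _ m<c = trans (partial-≮ r c c≮m) (sym (partial-≮ r c (ℕ.<⇒≱ m<c ∘ ℕ.≤-pred)))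
    column : ∀ r → partial m r m ≡ partial (suc m) r m xor Σ₂ m (λ k → L m k ∧ partial (suc m) r k)
    column r = begin
      partial m r m
        ≡⟨ partial-≮ r m (ℕ.n≮n m) ⟩
      Σ₂ (suc m) (λ k → L r k ∧ L m k)
        ≡⟨ Σ₂-last m (λ k → L r k ∧ L m k) ⟩
      Σ₂ m (λ k → L r k ∧ L m k) xor (L r m ∧ L m m)
        ≡⟨ cong (λ d → Σ₂ m (λ k → L r k ∧ L m k) xor (L r m ∧ d)) (diagonal m m<n) ⟩
      Σ₂ m (λ k → L r k ∧ L m k) xor (L r m ∧ true)
        ≡⟨ swap-unit (Σ₂ m (λ k → L r k ∧ L m k)) (L r m) ⟩
      L r m xor Σ₂ m (λ k → L r k ∧ L m k)
        ≡⟨ cong₂ _xor_ (sym (partial-< r m (ℕ.n<1+n m))) (Σ₂-cong m λ k k<m →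
            trans (∧-comm (L r k) (L m k))
                  (cong (L m k ∧_) (sym (partial-< r k (ℕ.m<n⇒m<1+n k<m))))) ⟩
      partial (suc m) r m xor Σ₂ m (λ k → L m k ∧ partial (suc m) r k) ∎
      where
      swap-unit : ∀ x y → x xor (y ∧ true) ≡ y xor x
      swap-unit = solve-∀ 𝔽₂

  reduce : ∀ d m → d + m ≡ n → det₂ n (partial m) ≡ true
  reduce zero    m refl = trans (det₂-cong m λ r c _ c<m → partial-< r c c<m) (det₂-lowerUnitriangular m lower)
  reduce (suc d) m refl = trans (reduceColumn m (s≤s (ℕ.m≤n+m m d))) (reduce d (suc m) (ℕ.+-suc d m))

motzkinStep : (ℕ → Bool) → ℕ → Bool
motzkinStep a zero    = a 0 xor a 1
motzkinStep a (suc k) = a k xor (a (suc k) xor a (suc (suc k)))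

-- The parity of the number of Motzkin paths of length i from height 0 to height k.
motzkinPaths₂ : ℕ → ℕ → Bool
motzkinPaths₂ zero    zero    = true
motzkinPaths₂ zero    (suc k) = false
motzkinPaths₂ (suc i) k       = motzkinStep (motzkinPaths₂ i) k

motzkin₂ : ℕ → Bool
motzkin₂ n = motzkinPaths₂ n 0

motzkinPaths₂-above : ∀ i k → i < k → motzkinPaths₂ i k ≡ false
motzkinPaths₂-above zero    (suc k) _         = refl
motzkinPaths₂-above (suc i) (suc k) (s<s i<k) =
  cong₂ _xor_ (motzkinPaths₂-above i k i<k)
    (cong₂ _xor_ (motzkinPaths₂-above i (suc k) (ℕ.m<n⇒m<1+n i<k))
                 (motzkinPaths₂-above i (suc (suc k)) (ℕ.m<n⇒m<1+n (ℕ.m<n⇒m<1+n i<k))))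

motzkinPaths₂-diagonal : ∀ i → motzkinPaths₂ i i ≡ true
motzkinPaths₂-diagonal zero    = refl
motzkinPaths₂-diagonal (suc i) =
  cong₂ _xor_ (motzkinPaths₂-diagonal i)
    (cong₂ _xor_ (motzkinPaths₂-above i (suc i) (ℕ.n<1+n i))
                 (motzkinPaths₂-above i (suc (suc i)) (ℕ.m<n⇒m<1+n (ℕ.n<1+n i))))

motzkinStep-telescope : ∀ (a b : ℕ → Bool) M →
  Σ₂ (suc M) (λ k → (motzkinStep a k ∧ b k) xor (a k ∧ motzkinStep b k))
    ≡ (a (suc M) ∧ b M) xor (a M ∧ b (suc M))
motzkinStep-telescope a b zero    = base (a 0) (a 1) (b 0) (b 1)
  where
  base : ∀ a₀ a₁ b₀ b₁ →
    (((a₀ xor a₁) ∧ b₀) xor (a₀ ∧ (b₀ xor b₁))) xor false ≡ (a₁ ∧ b₀) xor (a₀ ∧ b₁)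
  base = solve-∀ 𝔽₂
motzkinStep-telescope a b (suc M) = begin
  Σ₂ (suc (suc M)) term
    ≡⟨ Σ₂-last (suc M) term ⟩
  Σ₂ (suc M) term xor term (suc M)
    ≡⟨ cong (_xor term (suc M)) (motzkinStep-telescope a b M) ⟩
  ((a (suc M) ∧ b M) xor (a M ∧ b (suc M))) xor term (suc M)
    ≡⟨ step (a M) (a (suc M)) (a (suc (suc M))) (b M) (b (suc M)) (b (suc (suc M))) ⟩
  (a (suc (suc M)) ∧ b (suc M)) xor (a (suc M) ∧ b (suc (suc M))) ∎
  where
  term : ℕ → Bool
  term k = (motzkinStep a k ∧ b k) xor (a k ∧ motzkinStep b k)
  step : ∀ a₀ a₁ a₂ b₀ b₁ b₂ →
    ((a₁ ∧ b₀) xor (a₀ ∧ b₁)) xor (((a₀ xor (a₁ xor a₂)) ∧ b₁) xor (a₁ ∧ (b₀ xor (b₁ xor b₂))))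
      ≡ (a₂ ∧ b₁) xor (a₁ ∧ b₂)
  step = solve-∀ 𝔽₂

motzkinStep-selfAdjoint : ∀ (a b : ℕ → Bool) M → a (suc M) ≡ false → b (suc M) ≡ false →
  Σ₂ (suc M) (λ k → motzkinStep a k ∧ b k) ≡ Σ₂ (suc M) (λ k → a k ∧ motzkinStep b k)
motzkinStep-selfAdjoint a b M a-vanishes b-vanishes = xor≡false⇒≡ (begin
  Σ₂ (suc M) (λ k → motzkinStep a k ∧ b k) xor Σ₂ (suc M) (λ k → a k ∧ motzkinStep b k)
    ≡⟨ sym (Σ₂-xor (suc M) (λ k → motzkinStep a k ∧ b k) (λ k → a k ∧ motzkinStep b k)) ⟩
  Σ₂ (suc M) (λ k → (motzkinStep a k ∧ b k) xor (a k ∧ motzkinStep b k))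
    ≡⟨ motzkinStep-telescope a b M ⟩
  (a (suc M) ∧ b M) xor (a M ∧ b (suc M))
    ≡⟨ cong₂ (λ x y → (x ∧ b M) xor (a M ∧ y)) a-vanishes b-vanishes ⟩
  false xor (a M ∧ false)
    ≡⟨ ∧-zeroʳ (a M) ⟩
  false ∎)
  where
  xor≡false⇒≡ : ∀ {x y} → x xor y ≡ false → x ≡ y
  xor≡false⇒≡ {false} {false} _ = refl
  xor≡false⇒≡ {true}  {true}  _ = refl

motzkinPaths₂-gram : ∀ i j N → i + j < N →
  Σ₂ N (λ k → motzkinPaths₂ i k ∧ motzkinPaths₂ j k) ≡ motzkin₂ (i + j)
motzkinPaths₂-gram zero    j (suc N) _   =
  trans (cong (motzkin₂ j xor_) (Σ₂-zero N λ _ _ → refl)) (xor-identityʳ (motzkin₂ j))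
motzkinPaths₂-gram (suc i) j (suc M) i+j<N = begin
  Σ₂ (suc M) (λ k → motzkinStep (motzkinPaths₂ i) k ∧ motzkinPaths₂ j k)
    ≡⟨ motzkinStep-selfAdjoint (motzkinPaths₂ i) (motzkinPaths₂ j) M
         (motzkinPaths₂-above i (suc M) (ℕ.<-trans (s≤s (ℕ.m≤m+n i j)) i+j<N))
         (motzkinPaths₂-above j (suc M) (ℕ.<-trans (s≤s (ℕ.m≤n+m j i)) i+j<N)) ⟩
  Σ₂ (suc M) (λ k → motzkinPaths₂ i k ∧ motzkinPaths₂ (suc j) k)
    ≡⟨ motzkinPaths₂-gram i (suc j) (suc M) (subst (_< suc M) (sym (ℕ.+-suc i j)) i+j<N) ⟩
  motzkin₂ (i + suc j)
    ≡⟨ cong motzkin₂ (ℕ.+-suc i j) ⟩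
  motzkin₂ (suc i + j) ∎

hankel-motzkin₂ : ∀ n → det₂ n (λ r c → motzkin₂ (r + c)) ≡ true
hankel-motzkin₂ n = trans (det₂-cong n λ r c _ _ → sym (gram-motzkinPaths₂ r c)) (det₂-gram n lower)
  where
  lower : LowerUnitriangular n motzkinPaths₂
  lower = record
    { above    = λ i j i<j _ → motzkinPaths₂-above i j i<j
    ; diagonal = λ i _ → motzkinPaths₂-diagonal i
    }
  gram-motzkinPaths₂ : ∀ r c → gram motzkinPaths₂ r c ≡ motzkin₂ (r + c)
  gram-motzkinPaths₂ r c = begin
    Σ₂ (suc c) (λ k → motzkinPaths₂ r k ∧ motzkinPaths₂ c k)
      ≡⟨ sym (Σ₂-extend r (suc c) λ k c<k →
               trans (cong (motzkinPaths₂ r k ∧_) (motzkinPaths₂-above c k c<k)) (∧-zeroʳ _)) ⟩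
    Σ₂ (r + suc c) (λ k → motzkinPaths₂ r k ∧ motzkinPaths₂ c k)
      ≡⟨ motzkinPaths₂-gram r c (r + suc c) (subst (r + c <_) (sym (ℕ.+-suc r c)) (ℕ.n<1+n (r + c))) ⟩
    motzkin₂ (r + c) ∎

motzkinStep-cong : ∀ {f g : ℕ → Bool} → (∀ j → f j ≡ g j) → ∀ k → motzkinStep f k ≡ motzkinStep g k
motzkinStep-cong f≗g zero    = cong₂ _xor_ (f≗g 0) (f≗g 1)
motzkinStep-cong f≗g (suc k) = cong₂ _xor_ (f≗g k) (cong₂ _xor_ (f≗g (suc k)) (f≗g (suc (suc k))))

motzkinStep-linear : ∀ c (g h : ℕ → Bool) k →
  (c ∧ motzkinStep g k) xor motzkinStep h k ≡ motzkinStep (λ j → (c ∧ g j) xor h j) k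
motzkinStep-linear c g h zero    = linear₂ c (g 0) (g 1) (h 0) (h 1)
  where
  linear₂ : ∀ c x y u v → (c ∧ (x xor y)) xor (u xor v) ≡ ((c ∧ x) xor u) xor ((c ∧ y) xor v)
  linear₂ = solve-∀ 𝔽₂
motzkinStep-linear c g h (suc k) = linear₃ c (g k) (g (suc k)) (g (suc (suc k))) (h k) (h (suc k)) (h (suc (suc k)))
  where
  linear₃ : ∀ c x y z u v w → (c ∧ (x xor (y xor z))) xor (u xor (v xor w))
                            ≡ ((c ∧ x) xor u) xor (((c ∧ y) xor v) xor ((c ∧ z) xor w))
  linear₃ = solve-∀ 𝔽₂

motzkinStep-Σ₂ : ∀ N (c : ℕ → Bool) (f : ℕ → ℕ → Bool) k →
  Σ₂ N (λ a → c a ∧ motzkinStep (f a) k) ≡ motzkinStep (λ j → Σ₂ N (λ a → c a ∧ f a j)) k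
motzkinStep-Σ₂ zero    c f zero    = refl
motzkinStep-Σ₂ zero    c f (suc k) = refl
motzkinStep-Σ₂ (suc N) c f k =
  trans (cong ((c 0 ∧ motzkinStep (f 0) k) xor_) (motzkinStep-Σ₂ N (c ∘ suc) (f ∘ suc) k))
        (motzkinStep-linear (c 0) (f 0) (λ j → Σ₂ N (λ a → c (suc a) ∧ f (suc a) j)) k)

-- Separates the contribution of height 0, which only reaches height 1.
motzkinStep-shift : ∀ (g : ℕ → Bool) k →
  motzkinStep g (suc k) ≡ motzkinStep (g ∘ suc) k xor (g 0 ∧ motzkinPaths₂ 0 k)
motzkinStep-shift g zero    = shift₀ (g 0) (g 1) (g 2)
  where
  shift₀ : ∀ x y z → x xor (y xor z) ≡ (y xor z) xor (x ∧ true)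
  shift₀ = solve-∀ 𝔽₂
motzkinStep-shift g (suc k) = sym (trans (cong (motzkinStep (g ∘ suc) (suc k) xor_) (∧-zeroʳ (g 0))) (xor-identityʳ _))

motzkinPaths₂-lastReturn : ∀ n k →
  motzkinPaths₂ (suc n) (suc k) ≡ Σ₂ (suc n) (λ a → motzkin₂ a ∧ motzkinPaths₂ (n ∸ a) k)
motzkinPaths₂-lastReturn zero    zero    = refl
motzkinPaths₂-lastReturn zero    (suc k) = refl
motzkinPaths₂-lastReturn (suc n) k = begin
  motzkinStep (motzkinPaths₂ (suc n)) (suc k)
    ≡⟨ motzkinStep-shift (motzkinPaths₂ (suc n)) k ⟩
  motzkinStep (λ j → motzkinPaths₂ (suc n) (suc j)) k xor last
    ≡⟨ cong (_xor last) (motzkinStep-cong (motzkinPaths₂-lastReturn n) k) ⟩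
  motzkinStep (λ j → Σ₂ (suc n) (λ a → motzkin₂ a ∧ motzkinPaths₂ (n ∸ a) j)) k xor last
    ≡⟨ cong (_xor last) (sym (motzkinStep-Σ₂ (suc n) motzkin₂ (λ a → motzkinPaths₂ (n ∸ a)) k)) ⟩
  Σ₂ (suc n) (λ a → motzkin₂ a ∧ motzkinPaths₂ (suc (n ∸ a)) k) xor last
    ≡⟨ cong₂ _xor_ (Σ₂-cong (suc n) λ a a≤n →
                     cong (λ i → motzkin₂ a ∧ motzkinPaths₂ i k) (sym (ℕ.+-∸-assoc 1 (ℕ.≤-pred a≤n))))
                   (cong (λ i → motzkin₂ (suc n) ∧ motzkinPaths₂ i k) (sym (ℕ.n∸n≡0 n))) ⟩
  Σ₂ (suc n) term xor term (suc n)
    ≡⟨ sym (Σ₂-last (suc n) term) ⟩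
  Σ₂ (suc (suc n)) term ∎
  where
  last : Bool
  last = motzkin₂ (suc n) ∧ motzkinPaths₂ 0 k
  term : ℕ → Bool
  term a = motzkin₂ a ∧ motzkinPaths₂ (suc n ∸ a) k

motzkin₂-recurrence : ∀ n →
  motzkin₂ (suc (suc n)) ≡ motzkin₂ (suc n) xor Σ₂ (suc n) (λ a → motzkin₂ a ∧ motzkin₂ (n ∸ a))
motzkin₂-recurrence n = cong (motzkin₂ (suc n) xor_) (motzkinPaths₂-lastReturn n 0)

double : ℕ → ℕ
double zero    = zero
double (suc h) = suc (suc (double h))

Σ₂-antidiagonal-peel : ∀ m (F : ℕ → ℕ → Bool) → (∀ a b → F a b ≡ F b a) →
  Σ₂ (suc (suc (suc m))) (λ a → F a (suc (suc m) ∸ a)) ≡ Σ₂ (suc m) (λ a → F (suc a) (suc (m ∸ a)))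
Σ₂-antidiagonal-peel m F symmetric = begin
  F 0 (suc (suc m)) xor Σ₂ (suc (suc m)) (λ a → F (suc a) (suc m ∸ a))
    ≡⟨ cong (F 0 (suc (suc m)) xor_) (Σ₂-last (suc m) (λ a → F (suc a) (suc m ∸ a))) ⟩
  F 0 (suc (suc m)) xor (Σ₂ (suc m) (λ a → F (suc a) (suc m ∸ a)) xor F (suc (suc m)) (m ∸ m))
    ≡⟨ cong₂ (λ x y → F 0 (suc (suc m)) xor (x xor y))
             (Σ₂-cong (suc m) λ a a≤m → cong (F (suc a)) (ℕ.+-∸-assoc 1 (ℕ.≤-pred a≤m)))
             (trans (cong (F (suc (suc m))) (ℕ.n∸n≡0 m)) (symmetric (suc (suc m)) 0)) ⟩
  F 0 (suc (suc m)) xor (Σ₂ (suc m) (λ a → F (suc a) (suc (m ∸ a))) xor F 0 (suc (suc m)))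
    ≡⟨ cancel (F 0 (suc (suc m))) _ ⟩
  Σ₂ (suc m) (λ a → F (suc a) (suc (m ∸ a))) ∎
  where
  cancel : ∀ x y → x xor (y xor x) ≡ y
  cancel = solve-∀ 𝔽₂

Σ₂-antidiagonal-even : ∀ h (F : ℕ → ℕ → Bool) → (∀ a b → F a b ≡ F b a) →
  Σ₂ (suc (double h)) (λ a → F a (double h ∸ a)) ≡ F h h
Σ₂-antidiagonal-even zero    F symmetric = xor-identityʳ (F 0 0)
Σ₂-antidiagonal-even (suc h) F symmetric =
  trans (Σ₂-antidiagonal-peel (double h) F symmetric)
        (Σ₂-antidiagonal-even h (λ a b → F (suc a) (suc b)) (λ a b → symmetric (suc a) (suc b)))

Σ₂-antidiagonal-odd : ∀ h (F : ℕ → ℕ → Bool) → (∀ a b → F a b ≡ F b a) →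
  Σ₂ (suc (suc (double h))) (λ a → F a (suc (double h) ∸ a)) ≡ false
Σ₂-antidiagonal-odd zero    F symmetric = trans (cong (λ x → F 0 1 xor (x xor false)) (symmetric 1 0)) (cancel (F 0 1))
  where
  cancel : ∀ x → x xor (x xor false) ≡ false
  cancel = solve-∀ 𝔽₂
Σ₂-antidiagonal-odd (suc h) F symmetric =
  trans (Σ₂-antidiagonal-peel (suc (double h)) F symmetric)
        (Σ₂-antidiagonal-odd h (λ a b → F (suc a) (suc b)) (λ a b → symmetric (suc a) (suc b)))

motzkin₂-odd : ∀ h → motzkin₂ (suc (double h)) ≡ motzkin₂ (double h)
motzkin₂-odd zero    = refl
motzkin₂-odd (suc h) = begin
  motzkin₂ (suc (suc (suc (double h))))
    ≡⟨ motzkin₂-recurrence (suc (double h)) ⟩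
  motzkin₂ (suc (suc (double h)))
    xor Σ₂ (suc (suc (double h))) (λ a → motzkin₂ a ∧ motzkin₂ (suc (double h) ∸ a))
    ≡⟨ cong (motzkin₂ (suc (suc (double h))) xor_)
            (Σ₂-antidiagonal-odd h (λ a b → motzkin₂ a ∧ motzkin₂ b)
                                   (λ a b → ∧-comm (motzkin₂ a) (motzkin₂ b))) ⟩
  motzkin₂ (suc (suc (double h))) xor false
    ≡⟨ xor-identityʳ _ ⟩
  motzkin₂ (double (suc h)) ∎

motzkin₂-even : ∀ h → motzkin₂ (double (suc h)) ≡ motzkin₂ (suc (double h)) xor motzkin₂ h
motzkin₂-even h = begin
  motzkin₂ (suc (suc (double h)))
    ≡⟨ motzkin₂-recurrence (double h) ⟩
  motzkin₂ (suc (double h)) xor Σ₂ (suc (double h)) (λ a → motzkin₂ a ∧ motzkin₂ (double h ∸ a))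
    ≡⟨ cong (motzkin₂ (suc (double h)) xor_)
            (Σ₂-antidiagonal-even h (λ a b → motzkin₂ a ∧ motzkin₂ b)
                                    (λ a b → ∧-comm (motzkin₂ a) (motzkin₂ b))) ⟩
  motzkin₂ (suc (double h)) xor (motzkin₂ h ∧ motzkin₂ h)
    ≡⟨ cong (motzkin₂ (suc (double h)) xor_) (∧-idem (motzkin₂ h)) ⟩
  motzkin₂ (suc (double h)) xor motzkin₂ h ∎

isOdd : ℕ → Bool
isOdd zero          = false
isOdd (suc zero)    = true
isOdd (suc (suc n)) = isOdd n

-- Parity of the binary digit sum of n; the fuel f suffices as soon as n ≤ f.
thueMorseᶠ : ℕ → ℕ → Bool
thueMorseᶠ zero    n = false
thueMorseᶠ (suc f) n = isOdd n xor thueMorseᶠ f ⌊ n /2⌋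

thueMorse : ℕ → Bool
thueMorse n = thueMorseᶠ n n

thueMorseᶠ-suc : ∀ f n → n ≤ f → thueMorseᶠ (suc f) n ≡ thueMorseᶠ f n
thueMorseᶠ-suc zero    zero _     = refl
thueMorseᶠ-suc (suc f) n    n≤1+f =
  cong (isOdd n xor_) (thueMorseᶠ-suc f ⌊ n /2⌋ (ℕ.≤-trans (ℕ.⌊n/2⌋-mono n≤1+f) (ℕ.≤-pred (ℕ.⌊n/2⌋<n f))))

thueMorseᶠ-enough : ∀ {n f} → n ≤′ f → thueMorseᶠ f n ≡ thueMorse n
thueMorseᶠ-enough ≤′-refl       = refl
thueMorseᶠ-enough (≤′-step n≤f) = trans (thueMorseᶠ-suc _ _ (ℕ.≤′⇒≤ n≤f)) (thueMorseᶠ-enough n≤f)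

isOdd-double : ∀ h → isOdd (double h) ≡ false
isOdd-double zero    = refl
isOdd-double (suc h) = isOdd-double h

isOdd-suc-double : ∀ h → isOdd (suc (double h)) ≡ true
isOdd-suc-double zero    = refl
isOdd-suc-double (suc h) = isOdd-suc-double h

⌊double/2⌋ : ∀ h → ⌊ double h /2⌋ ≡ h
⌊double/2⌋ zero    = refl
⌊double/2⌋ (suc h) = cong suc (⌊double/2⌋ h)

⌊suc-double/2⌋ : ∀ h → ⌊ suc (double h) /2⌋ ≡ h
⌊suc-double/2⌋ zero    = refl
⌊suc-double/2⌋ (suc h) = cong suc (⌊suc-double/2⌋ h)

≤-double : ∀ h → h ≤ double h
≤-double zero    = z≤n
≤-double (suc h) = s≤s (ℕ.m≤n⇒m≤1+n (≤-double h))

thueMorse-double : ∀ h → thueMorse (double h) ≡ thueMorse h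
thueMorse-double zero    = refl
thueMorse-double (suc h) = begin
  isOdd (double h) xor thueMorseᶠ (suc (double h)) (suc ⌊ double h /2⌋)
    ≡⟨ cong₂ (λ b m → b xor thueMorseᶠ (suc (double h)) (suc m)) (isOdd-double h) (⌊double/2⌋ h) ⟩
  thueMorseᶠ (suc (double h)) (suc h)
    ≡⟨ thueMorseᶠ-enough (ℕ.≤⇒≤′ (s≤s (≤-double h))) ⟩
  thueMorse (suc h) ∎

thueMorse-suc-double : ∀ h → thueMorse (suc (double h)) ≡ not (thueMorse h)
thueMorse-suc-double h = begin
  isOdd (suc (double h)) xor thueMorseᶠ (double h) ⌊ suc (double h) /2⌋
    ≡⟨ cong₂ (λ b m → b xor thueMorseᶠ (double h) m) (isOdd-suc-double h) (⌊suc-double/2⌋ h) ⟩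
  not (thueMorseᶠ (double h) h)
    ≡⟨ cong not (thueMorseᶠ-enough (ℕ.≤⇒≤′ (≤-double h))) ⟩
  not (thueMorse h) ∎

data EvenOdd : ℕ → Set where
  even : ∀ h → EvenOdd (double h)
  odd  : ∀ h → EvenOdd (suc (double h))

evenOdd : ∀ n → EvenOdd n
evenOdd zero = even 0
evenOdd (suc n) with evenOdd n
... | even h = odd h
... | odd  h = even (suc h)

double-+ : ∀ a b → double a + double b ≡ double (a + b)
double-+ zero    b = refl
double-+ (suc a) b = cong (suc ∘ suc) (double-+ a b)

+-self≡double : ∀ x → x + x ≡ double x
+-self≡double zero    = refl
+-self≡double (suc x) = cong suc (trans (ℕ.+-suc x x) (cong suc (+-self≡double x)))

2^-suc : ∀ j → 2 ^ suc j ≡ 2 ^ j + 2 ^ j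
2^-suc j = cong (λ m → 2 ^ j + m) (ℕ.+-identityʳ (2 ^ j))

2^-suc≡double : ∀ j → 2 ^ suc j ≡ double (2 ^ j)
2^-suc≡double j = trans (2^-suc j) (+-self≡double (2 ^ j))

double-<-cancel : ∀ {h p} → double h < double p → h < p
double-<-cancel {zero}  {suc p} _                 = z<s
double-<-cancel {suc h} {suc p} (s<s (s<s 2h<2p)) = s<s (double-<-cancel 2h<2p)

suc-double-<-cancel : ∀ {h p} → suc (double h) < double p → h < p
suc-double-<-cancel {zero}  {suc p} _                   = z<s
suc-double-<-cancel {suc h} {suc p} (s<s (s<s 2h+1<2p)) = s<s (suc-double-<-cancel 2h+1<2p)

thueMorse-+-2^ : ∀ j n → n < 2 ^ j → thueMorse (n + 2 ^ j) ≡ not (thueMorse n)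
thueMorse-+-2^ zero    zero    _         = refl
thueMorse-+-2^ zero    (suc n) (s<s ())
thueMorse-+-2^ (suc j) n n<2^j+1 with evenOdd n | subst (n <_) (2^-suc≡double j) n<2^j+1
... | even h | 2h<2P = begin
  thueMorse (double h + 2 ^ suc j)        ≡⟨ cong (λ m → thueMorse (double h + m)) (2^-suc≡double j) ⟩
  thueMorse (double h + double (2 ^ j))   ≡⟨ cong thueMorse (double-+ h (2 ^ j)) ⟩
  thueMorse (double (h + 2 ^ j))          ≡⟨ thueMorse-double (h + 2 ^ j) ⟩
  thueMorse (h + 2 ^ j)                   ≡⟨ thueMorse-+-2^ j h (double-<-cancel 2h<2P) ⟩
  not (thueMorse h)                       ≡⟨ cong not (sym (thueMorse-double h)) ⟩
  not (thueMorse (double h))              ∎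
... | odd h | 2h+1<2P = begin
  thueMorse (suc (double h) + 2 ^ suc j)
    ≡⟨ cong (λ m → thueMorse (suc (double h) + m)) (2^-suc≡double j) ⟩
  thueMorse (suc (double h + double (2 ^ j)))
    ≡⟨ cong (thueMorse ∘ suc) (double-+ h (2 ^ j)) ⟩
  thueMorse (suc (double (h + 2 ^ j)))
    ≡⟨ thueMorse-suc-double (h + 2 ^ j) ⟩
  not (thueMorse (h + 2 ^ j))
    ≡⟨ cong not (thueMorse-+-2^ j h (suc-double-<-cancel 2h+1<2P)) ⟩
  not (not (thueMorse h))
    ≡⟨ cong not (sym (thueMorse-suc-double h)) ⟩
  not (thueMorse (suc (double h))) ∎

sumTo-zero : ∀ n (f : ℕ → ℤ) → (∀ i → i ≤ n → f i ≡ + 0) → sumTo n f ≡ + 0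
sumTo-zero zero    f vanish = vanish 0 z≤n
sumTo-zero (suc n) f vanish =
  cong₂ ℤ._+_ (sumTo-zero n f λ i i≤n → vanish i (ℕ.m≤n⇒m≤1+n i≤n)) (vanish (suc n) ℕ.≤-refl)

sumTo-single : ∀ n {a} (f : ℕ → ℤ) → a ≤ n → (∀ i → i ≤ n → i ≢ a → f i ≡ + 0) → sumTo n f ≡ f a
sumTo-single zero    f z≤n _ = refl
sumTo-single (suc n) {a} f a≤n vanish with a ℕ.≟ suc n
... | yes refl = trans
  (cong (ℤ._+ f (suc n)) (sumTo-zero n f λ i i≤n → vanish i (ℕ.m≤n⇒m≤1+n i≤n) (ℕ.<⇒≢ (s≤s i≤n))))
  (ℤ.+-identityˡ (f (suc n)))
... | no  a≢n  = trans
  (cong₂ ℤ._+_ (sumTo-single n f (ℕ.≤-pred (ℕ.≤∧≢⇒< a≤n a≢n)) λ i i≤n → vanish i (ℕ.m≤n⇒m≤1+n i≤n))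
               (vanish (suc n) ℕ.≤-refl (a≢n ∘ sym)))
  (ℤ.+-identityʳ (f a))

sumTo-pair : ∀ n {a b} (f : ℕ → ℤ) → a < b → b ≤ n →
  (∀ i → i ≤ n → i ≢ a → i ≢ b → f i ≡ + 0) → sumTo n f ≡ f a ℤ.+ f b
sumTo-pair zero    f () z≤n _
sumTo-pair (suc n) {a} {b} f a<b b≤n vanish with b ℕ.≟ suc n
... | yes refl = cong (ℤ._+ f (suc n)) (sumTo-single n f (ℕ.≤-pred a<b) λ i i≤n i≢a →
                   vanish i (ℕ.m≤n⇒m≤1+n i≤n) i≢a (ℕ.<⇒≢ (s≤s i≤n)))
... | no  b≢n  = trans
  (cong₂ ℤ._+_ (sumTo-pair n f a<b (ℕ.≤-pred (ℕ.≤∧≢⇒< b≤n b≢n)) λ i i≤n → vanish i (ℕ.m≤n⇒m≤1+n i≤n))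
               (vanish (suc n) ℕ.≤-refl (ℕ.<⇒≢ (ℕ.<-≤-trans a<b b≤n) ∘ sym) (b≢n ∘ sym)))
  (ℤ.+-identityʳ _)

isYes-false : ∀ {A : Set} (a? : Dec A) → ¬ A → isYes a? ≡ false
isYes-false a? ¬a = trans (isYes≗does a?) (dec-false a? ¬a)

2^≢0 : ∀ k → 2 ^ k ≢ 0
2^≢0 k = ℕ.>⇒≢ (ℕ.m^n>0 2 k)

factor-2^ : ∀ k → factor k (2 ^ k) ≡ -[1+ 0 ]
factor-2^ k = cong₂ (λ b c → if b then + 1 else if c then -[1+ 0 ] else + 0)
  (isYes-false (2 ^ k ℕ.≟ 0) (2^≢0 k)) (trans (isYes≗does (2 ^ k ℕ.≟ 2 ^ k)) (dec-true (2 ^ k ℕ.≟ 2 ^ k) refl))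

factor-other : ∀ k m → m ≢ 0 → m ≢ 2 ^ k → factor k m ≡ + 0
factor-other k m m≢0 m≢2^k = cong₂ (λ b c → if b then + 1 else if c then -[1+ 0 ] else + 0)
  (isYes-false (m ℕ.≟ 0) m≢0) (isYes-false (m ℕ.≟ 2 ^ k) m≢2^k)

⊛-factor-< : ∀ f k n → n < 2 ^ k → (f ⊛ factor k) n ≡ f n
⊛-factor-< f k n n<2^k = begin
  sumTo n (λ i → f i ℤ.* factor k (n ∸ i))  ≡⟨ sumTo-single n _ ℕ.≤-refl vanish ⟩
  f n ℤ.* factor k (n ∸ n)                  ≡⟨ cong (λ m → f n ℤ.* factor k m) (ℕ.n∸n≡0 n) ⟩
  f n ℤ.* + 1                               ≡⟨ ℤ.*-identityʳ (f n) ⟩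
  f n                                       ∎
  where
  vanish : ∀ i → i ≤ n → i ≢ n → f i ℤ.* factor k (n ∸ i) ≡ + 0
  vanish i i≤n i≢n = trans (cong (f i ℤ.*_) (factor-other k (n ∸ i)
      (λ n∸i≡0 → i≢n (ℕ.≤-antisym i≤n (ℕ.m∸n≡0⇒m≤n n∸i≡0)))
      (λ n∸i≡2^k → ℕ.<-irrefl n∸i≡2^k (ℕ.≤-<-trans (ℕ.m∸n≤m n i) n<2^k))))
    (ℤ.*-zeroʳ (f i))

⊛-factor-≥ : ∀ f k n → 2 ^ k ≤ n → (f ⊛ factor k) n ≡ ℤ.- f (n ∸ 2 ^ k) ℤ.+ f n
⊛-factor-≥ f k n 2^k≤n = begin
  sumTo n (λ i → f i ℤ.* factor k (n ∸ i))
    ≡⟨ sumTo-pair n _ (ℕ.∸-monoʳ-< (ℕ.m^n>0 2 k) 2^k≤n) ℕ.≤-refl vanish ⟩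
  f (n ∸ 2 ^ k) ℤ.* factor k (n ∸ (n ∸ 2 ^ k)) ℤ.+ f n ℤ.* factor k (n ∸ n)
    ≡⟨ cong₂ (λ a b → f (n ∸ 2 ^ k) ℤ.* factor k a ℤ.+ f n ℤ.* factor k b)
             (ℕ.m∸[m∸n]≡n 2^k≤n) (ℕ.n∸n≡0 n) ⟩
  f (n ∸ 2 ^ k) ℤ.* factor k (2 ^ k) ℤ.+ f n ℤ.* + 1
    ≡⟨ cong₂ ℤ._+_ (trans (cong (f (n ∸ 2 ^ k) ℤ.*_) (factor-2^ k)) (ℤ.*-comm (f (n ∸ 2 ^ k)) -[1+ 0 ]))
                   (ℤ.*-identityʳ (f n)) ⟩
  -[1+ 0 ] ℤ.* f (n ∸ 2 ^ k) ℤ.+ f n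
    ≡⟨ cong (ℤ._+ f n) (ℤ.-1*i≡-i (f (n ∸ 2 ^ k))) ⟩
  ℤ.- f (n ∸ 2 ^ k) ℤ.+ f n ∎
  where
  vanish : ∀ i → i ≤ n → i ≢ n ∸ 2 ^ k → i ≢ n → f i ℤ.* factor k (n ∸ i) ≡ + 0
  vanish i i≤n i≢n∸2^k i≢n = trans (cong (f i ℤ.*_) (factor-other k (n ∸ i)
      (λ n∸i≡0 → i≢n (ℕ.≤-antisym i≤n (ℕ.m∸n≡0⇒m≤n n∸i≡0)))
      (λ n∸i≡2^k → i≢n∸2^k (trans (sym (ℕ.m∸[m∸n]≡n i≤n)) (cong (n ∸_) n∸i≡2^k)))))
    (ℤ.*-zeroʳ (f i))

sgn : Bool → ℤ
sgn false = + 1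
sgn true  = -[1+ 0 ]

partialProd-vanishes : ∀ K n → 2 ^ suc K ≤ n → partialProd K n ≡ + 0
partialProd-vanishes zero    (suc zero)    (s≤s ())
partialProd-vanishes zero    (suc (suc n)) _     = refl
partialProd-vanishes (suc K) n             4P≤n  =
  trans (⊛-factor-≥ (partialProd K) (suc K) n P≤n)
        (cong₂ (λ x y → ℤ.- x ℤ.+ y) (partialProd-vanishes K (n ∸ P) P≤n∸P) (partialProd-vanishes K n P≤n))
  where
  P : ℕ
  P = 2 ^ suc K
  2P≤n : P + P ≤ n
  2P≤n = subst (_≤ n) (2^-suc (suc K)) 4P≤n
  P≤n : P ≤ n
  P≤n = ℕ.≤-trans (ℕ.m≤m+n P P) 2P≤n
  P≤n∸P : P ≤ n ∸ P
  P≤n∸P = subst (_≤ n ∸ P) (ℕ.m+n∸n≡m P P) (ℕ.∸-monoˡ-≤ P 2P≤n)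

partialProd-thueMorse : ∀ K n → n < 2 ^ suc K → partialProd K n ≡ sgn (thueMorse n)
partialProd-thueMorse zero    zero       _ = refl
partialProd-thueMorse zero    (suc zero) _ = refl
partialProd-thueMorse zero    (suc (suc n)) (s<s (s<s ()))
partialProd-thueMorse (suc K) n n<4P with n ℕ.<? 2 ^ suc K
... | yes n<P = trans (⊛-factor-< (partialProd K) (suc K) n n<P) (partialProd-thueMorse K n n<P)
... | no  n≮P = begin
  (partialProd K ⊛ factor (suc K)) n
    ≡⟨ ⊛-factor-≥ (partialProd K) (suc K) n P≤n ⟩
  ℤ.- partialProd K (n ∸ P) ℤ.+ partialProd K n
    ≡⟨ cong₂ (λ x y → ℤ.- x ℤ.+ y) (partialProd-thueMorse K (n ∸ P) n∸P<P)
                                   (partialProd-vanishes K n P≤n) ⟩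
  ℤ.- sgn (thueMorse (n ∸ P)) ℤ.+ + 0
    ≡⟨ negate (thueMorse (n ∸ P)) ⟩
  sgn (not (thueMorse (n ∸ P)))
    ≡⟨ cong sgn (sym (thueMorse-+-2^ (suc K) (n ∸ P) n∸P<P)) ⟩
  sgn (thueMorse (n ∸ P + P))
    ≡⟨ cong (sgn ∘ thueMorse) (ℕ.m∸n+n≡m P≤n) ⟩
  sgn (thueMorse n) ∎
  where
  P : ℕ
  P = 2 ^ suc K
  P≤n : P ≤ n
  P≤n = ℕ.≮⇒≥ n≮P
  n∸P<P : n ∸ P < P
  n∸P<P = subst (n ∸ P <_) (ℕ.m+n∸n≡m P P) (ℕ.∸-monoˡ-< (subst (n <_) (2^-suc (suc K)) n<4P) P≤n)
  negate : ∀ b → ℤ.- sgn b ℤ.+ + 0 ≡ sgn (not b)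
  negate false = refl
  negate true  = refl

n<2^n : ∀ n → n < 2 ^ n
n<2^n zero    = z<s
n<2^n (suc n) = subst (suc n <_) (sym (2^-suc n)) (ℕ.+-mono-≤ (ℕ.m^n>0 2 n) (n<2^n n))

η-thueMorse : ∀ n → η n ≡ sgn (thueMorse n)
η-thueMorse n = partialProd-thueMorse n n (ℕ.<-≤-trans (n<2^n n) (ℕ.m≤m+n (2 ^ n) _))

γ₂ : ℕ → Bool
γ₂ n = thueMorse n xor thueMorse (suc (suc n))

γ-≡₂ : ∀ n → γ n ≡₂ γ₂ n
γ-≡₂ n = subst₂ (λ x y → ((x ℤ.- y) / 1) ℚ.* (+ 1 / 2) ≡₂ γ₂ n)
  (sym (η-thueMorse n)) (sym (η-thueMorse (suc (suc n)))) (halfDifference (thueMorse n) (thueMorse (suc (suc n))))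
  where
  halfDifference : ∀ a b → ((sgn a ℤ.- sgn b) / 1) ℚ.* (+ 1 / 2) ≡₂ a xor b
  halfDifference false false = + 0 , refl
  halfDifference false true  = + 0 , refl
  halfDifference true  false = -[1+ 0 ] , refl
  halfDifference true  true  = + 0 , refl

γ₂-odd : ∀ h → γ₂ (suc (double h)) ≡ γ₂ (double h)
γ₂-odd h = begin
  thueMorse (suc (double h)) xor thueMorse (suc (double (suc h)))
    ≡⟨ cong₂ _xor_ (thueMorse-suc-double h) (thueMorse-suc-double (suc h)) ⟩
  not (thueMorse h) xor not (thueMorse (suc h))
    ≡⟨ xor-annihilates-not (thueMorse h) (thueMorse (suc h)) ⟩
  thueMorse h xor thueMorse (suc h)
    ≡⟨ sym (cong₂ _xor_ (thueMorse-double h) (thueMorse-double (suc h))) ⟩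
  thueMorse (double h) xor thueMorse (double (suc h)) ∎

γ₂-even : ∀ h → γ₂ (double (suc h)) ≡ γ₂ (suc (double h)) xor γ₂ h
γ₂-even h = begin
  thueMorse (double (suc h)) xor thueMorse (double (suc (suc h)))
    ≡⟨ cong₂ _xor_ (thueMorse-double (suc h)) (thueMorse-double (suc (suc h))) ⟩
  thueMorse (suc h) xor thueMorse (suc (suc h))
    ≡⟨ cancel (thueMorse h) (thueMorse (suc h)) (thueMorse (suc (suc h))) ⟩
  (thueMorse h xor thueMorse (suc h)) xor γ₂ h
    ≡⟨ cong (_xor γ₂ h) (sym (xor-annihilates-not (thueMorse h) (thueMorse (suc h)))) ⟩
  (not (thueMorse h) xor not (thueMorse (suc h))) xor γ₂ h
    ≡⟨ cong (_xor γ₂ h) (sym (cong₂ _xor_ (thueMorse-suc-double h) (thueMorse-suc-double (suc h)))) ⟩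
  γ₂ (suc (double h)) xor γ₂ h ∎
  where
  cancel : ∀ a b c → b xor c ≡ (a xor b) xor (a xor c)
  cancel = solve-∀ 𝔽₂

motzkin₂≡γ₂ : ∀ n → motzkin₂ n ≡ γ₂ n
motzkin₂≡γ₂ = <-rec (λ n → motzkin₂ n ≡ γ₂ n) step
  where
  step : ∀ n → (∀ {m} → m < n → motzkin₂ m ≡ γ₂ m) → motzkin₂ n ≡ γ₂ n
  step n rec with evenOdd n
  ... | even zero    = refl
  ... | even (suc h) = begin
    motzkin₂ (double (suc h))                    ≡⟨ motzkin₂-even h ⟩
    motzkin₂ (suc (double h)) xor motzkin₂ h     ≡⟨ cong₂ _xor_ (rec (ℕ.n<1+n (suc (double h))))
                                                                (rec (s≤s (ℕ.m≤n⇒m≤1+n (≤-double h)))) ⟩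
    γ₂ (suc (double h)) xor γ₂ h                 ≡⟨ sym (γ₂-even h) ⟩
    γ₂ (double (suc h))                          ∎
  ... | odd h = trans (motzkin₂-odd h) (trans (rec (ℕ.n<1+n (double h))) (sym (γ₂-odd h)))

hankel-γ-odd : ∀ n → hankel γ n ≡₂ true
hankel-γ-odd n = subst (hankel γ n ≡₂_)
  (trans (det₂-cong n λ r c _ _ → sym (motzkin₂≡γ₂ (r + c))) (hankel-motzkin₂ n))
  (det-≡₂ n λ i j → γ-≡₂ (toℕ i + toℕ j))

proposition2p4 : (n : ℕ) → n ℕ.≥ 1 →
    ∃[ m ] hankel γ n ≡ (+ 1 ℤ.+ + 2 ℤ.* m) / 1
proposition2p4 n _ with hankel-γ-odd n
... | m , eq = m , eq
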